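{- Let $d \geq 12$ be an integer. Then for all integers $n$ with $d+2 \leq n \leq 5d$, \[ q_d^{(1)}(n) \geq Q_{d-4}^{(1,-)}(n). \]
   Context: $q_d^{(1)}(n)$ denotes the number of partitions of $n$ into parts such that any two parts differ by at least $d$. $Q_{d-4}^{(1,-)}(n)$ denotes the number of partitions of $n$ into parts congruent to $1$ or $-1$ modulo $d-1$, where the part $d-2$ is not allowed. -}

module Defs where

open import Data.Nat using (ℕ; zero; suc; _+_; _∸_; _≤_; _≤ᵇ_; _≡ᵇ_)
open import Data.Nat.Divisibility using (_∣?_)
open import Data.Bool using (Bool; true; false; _∧_; _∨_; not)
open import Data.List using (List; []; _∷_; [_]; map; concatMap; filterᵇ; length; upTo)
open import Relation.Nullary.Decidable using (⌊_⌋)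

-- pb f n m : all partitions of n (as nonincreasing lists of positive parts)
-- whose largest part is ≤ m; f is fuel (f ≥ n suffices, since every step
-- removes a positive part).
pb : ℕ → ℕ → ℕ → List (List ℕ)
pb _       zero    _ = [ [] ]
pb zero    (suc n) _ = []
pb (suc f) (suc n) m =
  concatMap (λ k → map (k ∷_) (pb f (suc n ∸ k) k))
            (filterᵇ (λ k → k ≤ᵇ m) (map suc (upTo (suc n))))

partitions : ℕ → List (List ℕ)
partitions n = pb n n n

gapᵇ : ℕ → List ℕ → Bool
gapᵇ d []           = true
gapᵇ d (a ∷ [])     = true
gapᵇ d (a ∷ b ∷ xs) = (b + d ≤ᵇ a) ∧ gapᵇ d (b ∷ xs)

q1 : ℕ → ℕ → ℕ
q1 d n = length (filterᵇ (gapᵇ d) (partitions n))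

okPartᵇ : ℕ → ℕ → Bool
okPartᵇ d p = (⌊ (d ∸ 1) ∣? (p ∸ 1) ⌋ ∨ ⌊ (d ∸ 1) ∣? (p + 1) ⌋) ∧ not (p ≡ᵇ (d ∸ 2))

allᵇ : (ℕ → Bool) → List ℕ → Bool
allᵇ p []       = true
allᵇ p (x ∷ xs) = p x ∧ allᵇ p xs

-- Q_{d-4}^{(1,-)}(n): partitions of n into parts ≡ ±1 (mod d-1), part d-2 excluded
Q1m : ℕ → ℕ → ℕ
Q1m d n = length (filterᵇ (allᵇ (okPartᵇ d)) (partitions n))

-- With d = 12 + e and n ≤ 5d, a partition counted by Q1m d n consists of ones and big parts
-- k (d − 1) ± 1 with k ≤ 5 (the part d − 2 being excluded), so it is determined by its multiset
-- of big parts, and only 36 such multisets fit below 5d. Writing each part as a linear form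
-- a e + b makes the order of parts and every comparison that matters independent of e, so these
-- finitely many facts are checked by evaluation. An explicit table sends each multiset to a
-- partition of n into one, two or three parts with gaps at least d; distinct multisets get distinct
-- images, and the image is a valid partition whenever the big parts fit into n and n ≥ d + 2.

module Submission where

open import Defs
open import Data.Bool using (Bool; T; T?; _∧_)
open import Data.Bool.Properties using (T-∧; T-∨; T-not-≡)
open import Data.Empty using (⊥; ⊥-elim)
open import Data.List using (List; []; _∷_; [_]; _++_; map; concatMap; filter; filterᵇ; length; replicate; upTo)
open import Data.List.Properties using (∷-injectiveˡ; ∷-injectiveʳ; length-++; length-map)
open import Data.List.Membership.Propositional using (_∈_)
open import Data.List.Membership.Propositional.Properties
open import Data.List.Relation.Binary.Subset.Propositional using (_⊆_)
open import Data.List.Relation.Unary.Any using (here; there)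
open import Data.List.Relation.Unary.All as All using (All; []; _∷_; all?)
import Data.List.Relation.Unary.All.Properties as All
import Data.List.Relation.Unary.AllPairs as AllPairs
open AllPairs using ([]; _∷_)
import Data.List.Relation.Unary.AllPairs.Properties as AllPairs
open import Data.List.Relation.Unary.Unique.Propositional using (Unique)
import Data.List.Relation.Unary.Unique.Propositional.Properties as Unique
open import Data.Nat using (ℕ; zero; suc; _+_; _*_; _∸_; _≤_; _<_; _≥_; _≤?_; _<?_; _≟_; z≤n; s≤s; _≤ᵇ_)
open import Data.Nat.Properties
open import Data.Nat.ListAction using (sum)
open import Data.Nat.ListAction.Properties using (sum-++)
open import Data.Nat.Divisibility using (divides; _∣?_)
open import Data.Nat.Tactic.RingSolver using (solve-∀)
open import Data.Product using (Σ; ∃₂; _×_; _,_; proj₁; proj₂)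
open import Data.Product.Properties using (≡-dec)
open import Data.Sum using (_⊎_; inj₁; inj₂)
open import Data.Unit using (⊤; tt)
open import Function using (_∘_; Equivalence)
open import Relation.Binary.PropositionalEquality hiding ([_])
open import Relation.Nullary using (Dec; yes; no; ¬_; contradiction)
open import Data.List.Membership.DecPropositional (≡-dec _≟_ _≟_) using (_∈?_)
open import Relation.Nullary.Decidable using (from-yes; toWitness; _→-dec_; _×-dec_; _⊎-dec_)

unique-⊆-length≤ : ∀ {A : Set} {xs ys : List A} → Unique xs → xs ⊆ ys → length xs ≤ length ys
unique-⊆-length≤ {xs = []} _ _ = z≤n
unique-⊆-length≤ {xs = x ∷ xs} (x∉xs ∷ u) xs⊆ys with ∈-∃++ (xs⊆ys (here refl))
... | us , vs , refl = begin
    suc (length xs)             ≤⟨ s≤s (unique-⊆-length≤ u xs⊆us++vs) ⟩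
    suc (length (us ++ vs))     ≡⟨ cong suc (length-++ us) ⟩
    suc (length us + length vs) ≡⟨ +-suc (length us) (length vs) ⟨
    length us + length (x ∷ vs) ≡⟨ length-++ us ⟨
    length (us ++ x ∷ vs)       ∎
  where
  open ≤-Reasoning
  xs⊆us++vs : xs ⊆ us ++ vs
  xs⊆us++vs {y} y∈xs with ∈-++⁻ us (xs⊆ys (there y∈xs))
  ... | inj₁ y∈us         = ∈-++⁺ˡ y∈us
  ... | inj₂ (here refl)  = contradiction refl (All.lookup x∉xs y∈xs)
  ... | inj₂ (there y∈vs) = ∈-++⁺ʳ us y∈vs

Descending : ℕ → List ℕ → Set
Descending m []       = ⊤
Descending m (x ∷ xs) = 1 ≤ x × x ≤ m × Descending x xs

private
  candidates : ℕ → ℕ → List ℕ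
  candidates n m = filterᵇ (_≤ᵇ m) (map suc (upTo (suc n)))

∈-pb⁻ : ∀ f n m {xs} → xs ∈ pb f n m → Descending m xs × sum xs ≡ n
∈-pb⁻ f zero m (here refl) = tt , refl
∈-pb⁻ (suc f) (suc n) m xs∈
  with _ , x∷ys∈ , block∈
         ← ∈-concat⁻′ (map (λ k → map (k ∷_) (pb f (suc n ∸ k) k)) (candidates n m)) xs∈
  with k , k∈ , refl ← ∈-map⁻ (λ k → map (k ∷_) (pb f (suc n ∸ k) k)) block∈
  with ys , ys∈ , refl ← ∈-map⁻ (k ∷_) x∷ys∈
  with j∈ , k≤m ← ∈-filter⁻ (T? ∘ (_≤ᵇ m)) {xs = map suc (upTo (suc n))} k∈
  with j , j∈ , refl ← ∈-map⁻ suc j∈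
  with ys↓ , ∑ys ← ∈-pb⁻ f (suc n ∸ k) k ys∈
  = (s≤s z≤n , ≤ᵇ⇒≤ k m k≤m , ys↓) , trans (cong (k +_) ∑ys) (m+[n∸m]≡n (∈-upTo⁻ j∈))

∈-pb⁺ : ∀ f n m {xs} → Descending m xs → sum xs ≡ n → n ≤ f → xs ∈ pb f n m
∈-pb⁺ f       zero    m {[]}         _ _ _ = here refl
∈-pb⁺ (suc f) (suc n) m {k@(suc _) ∷ ys} (1≤k , k≤m , ys↓) ∑≡ (s≤s n≤f) =
  ∈-concat⁺′ (∈-map⁺ (k ∷_) ys∈) (∈-map⁺ (λ k → map (k ∷_) (pb f (suc n ∸ k) k)) k∈)
  where
  k≤1+n : k ≤ suc n
  k≤1+n = subst (k ≤_) ∑≡ (m≤m+n k (sum ys))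
  ys∈ : ys ∈ pb f (suc n ∸ k) k
  ys∈ = ∈-pb⁺ f (suc n ∸ k) k ys↓ (trans (sym (m+n∸m≡n k (sum ys))) (cong (_∸ k) ∑≡))
          (≤-trans (∸-monoʳ-≤ (suc n) 1≤k) n≤f)
  k∈ : k ∈ candidates n m
  k∈ = ∈-filter⁺ (T? ∘ (_≤ᵇ m)) (∈-map⁺ suc (∈-upTo⁺ k≤1+n)) (≤⇒≤ᵇ k≤m)
∈-pb⁺ zero    (suc n) m _ _ ()
∈-pb⁺ f       (suc n) m {[]} _ () _
∈-pb⁺ f       zero    m {suc x ∷ xs} _ () _

concatMap-∷-unique : ∀ {A : Set} {ks : List A} (g : A → List (List A)) →
  Unique ks → (∀ k → Unique (g k)) → Unique (concatMap (λ k → map (k ∷_) (g k)) ks)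
concatMap-∷-unique {ks = ks} g ks! g! =
  Unique.concat⁺ (All.map⁺ (All.universal (λ k → Unique.map⁺ ∷-injectiveʳ (g! k)) ks))
                 (AllPairs.map⁺ (AllPairs.map disjoint ks!))
  where
  disjoint : ∀ {k k′} → k ≢ k′ → ∀ {zs} → ¬ (zs ∈ map (k ∷_) (g k) × zs ∈ map (k′ ∷_) (g k′))
  disjoint k≢k′ (zs∈ , zs∈′) with _ , _ , refl ← ∈-map⁻ _ zs∈ with _ , _ , eq ← ∈-map⁻ _ zs∈′ =
    k≢k′ (∷-injectiveˡ eq)

pb-unique : ∀ f n m → Unique (pb f n m)
pb-unique f       zero    m = [] ∷ []
pb-unique zero    (suc n) m = []
pb-unique (suc f) (suc n) m = concatMap-∷-unique (λ k → pb f (suc n ∸ k) k)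
  (Unique.filter⁺ (T? ∘ (_≤ᵇ m)) (Unique.map⁺ suc-injective (Unique.upTo⁺ (suc n))))
  (λ k → pb-unique f (suc n ∸ k) k)

-- With d = 12 + e, a pair (a , b) stands for the number a * e + b.
Part : Set
Part = ℕ × ℕ

value : ℕ → Part → ℕ
value e (a , b) = a * e + b

-- k (d − 1) + 1 and k (d − 1) − 1
above below : ℕ → Part
above k = k , 1 + 11 * k
below k = k , 11 * k ∸ 1

-- The parts other than 1 that Q1m d allows below 5d, in decreasing order.
bigParts : List Part
bigParts = above 5 ∷ below 5 ∷ above 4 ∷ below 4 ∷ above 3 ∷ below 3 ∷ above 2 ∷ below 2 ∷ above 1 ∷ []

value-above : ∀ e k → value e (above k) ≡ suc (k * (11 + e))
value-above e k = lemma e k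
  where
  lemma : ∀ e k → k * e + (1 + 11 * k) ≡ suc (k * (11 + e))
  lemma = solve-∀

value-below : ∀ e k → value e (below (suc k)) + 1 ≡ suc k * (11 + e)
value-below e k = lemma e k
  where
  lemma : ∀ e k → suc k * e + (k + 10 * suc k) + 1 ≡ suc k * (11 + e)
  lemma = solve-∀

above-∈ : ∀ {k} → 1 ≤ k → k ≤ 5 → above k ∈ bigParts
above-∈ 1≤k k≤5 =
  All.lookup (from-yes (all? (λ k → 1 ≤? k →-dec above k ∈? bigParts) (upTo 6))) (∈-upTo⁺ (s≤s k≤5)) 1≤k

below-∈ : ∀ {k} → 2 ≤ k → k ≤ 5 → below k ∈ bigParts
below-∈ 2≤k k≤5 =
  All.lookup (from-yes (all? (λ k → 2 ≤? k →-dec below k ∈? bigParts) (upTo 6))) (∈-upTo⁺ (s≤s k≤5)) 2≤k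

multiple-too-large : ∀ e q → 6 ≤ q → q * (11 + e) ≤ suc (5 * e + 60) → ⊥
multiple-too-large e q 6≤q q*m≤ = <⇒≱ (begin-strict
    suc (5 * e + 60)                 <⟨ s≤s (m≤m+n (suc (5 * e + 60)) (e + 4)) ⟩
    suc (suc (5 * e + 60) + (e + 4)) ≡⟨ lemma e ⟨
    6 * (11 + e)                     ≤⟨ *-monoˡ-≤ (11 + e) 6≤q ⟩
    q * (11 + e)                     ∎) q*m≤
  where
  open ≤-Reasoning
  lemma : ∀ e → 6 * (11 + e) ≡ suc (suc (5 * e + 60) + (e + 4))
  lemma = solve-∀

Allowed : ℕ → ℕ → Set
Allowed e x = x ≡ 1 ⊎ x ∈ map (value e) bigParts

allowed-above : ∀ e x q → x ≡ q * (11 + e) → suc x ≤ 5 * e + 60 → Allowed e (suc x)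
allowed-above e x zero    refl _ = inj₁ refl
allowed-above e x q@(suc _) x≡ x<
  with q ≤? 5
... | yes q≤5 = inj₂ (subst (_∈ map (value e) bigParts) (trans (value-above e q) (cong suc (sym x≡)))
                        (∈-map⁺ (value e) (above-∈ (s≤s z≤n) q≤5)))
... | no  q≰5 = ⊥-elim (multiple-too-large e q (≰⇒> q≰5)
                          (subst (_≤ suc (5 * e + 60)) x≡ (≤-trans (n≤1+n x) (≤-trans x< (n≤1+n _)))))

allowed-below : ∀ e x q → x + 1 ≡ q * (11 + e) → x ≢ 10 + e → x ≤ 5 * e + 60 → Allowed e x
allowed-below e x (suc zero) x+1≡ x≢ _ = ⊥-elim (x≢ (+-cancelʳ-≡ 1 x (10 + e) (trans x+1≡ (lemma e))))
  where
  lemma : ∀ e → 1 * (11 + e) ≡ 10 + e + 1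
  lemma = solve-∀
allowed-below e x q@(suc (suc k)) x+1≡ _ x≤
  with q ≤? 5
... | yes q≤5 = inj₂ (subst (_∈ map (value e) bigParts)
                               (+-cancelʳ-≡ 1 _ x (trans (value-below e (suc k)) (sym x+1≡)))
                        (∈-map⁺ (value e) (below-∈ (s≤s (s≤s z≤n)) q≤5)))
... | no  q≰5 = ⊥-elim (multiple-too-large e q (≰⇒> q≰5)
                          (subst (_≤ suc (5 * e + 60)) x+1≡ (≤-trans (≤-reflexive (+-comm x 1)) (s≤s x≤))))
allowed-below e zero    zero () _ _
allowed-below e (suc x) zero () _ _

okPart⇒Allowed : ∀ e x → T (okPartᵇ (12 + e) x) → 1 ≤ x → x ≤ 5 * e + 60 → Allowed e x
okPart⇒Allowed e x@(suc x′) ok _ x≤ with Equivalence.to T-∧ ok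
... | ±1 , ≢d-2 with Equivalence.to T-∨ ±1
...   | inj₁ m∣x′   with divides q eq ← toWitness {a? = (11 + e) ∣? x′} m∣x′ =
  allowed-above e x′ q eq x≤
...   | inj₂ m∣x+1 with divides q eq ← toWitness {a? = (11 + e) ∣? (x + 1)} m∣x+1 =
  allowed-below e x q eq (λ x≡ → subst T (Equivalence.to T-not-≡ ≢d-2) (≡⇒≡ᵇ x (10 + e) x≡)) x≤

weight offset : List Part → ℕ
weight c = sum (map proj₁ c)
offset c = sum (map proj₂ c)

size : ℕ → List Part → ℕ
size e c = sum (map (value e) c)

size-linear : ∀ e c → size e c ≡ weight c * e + offset c
size-linear e []            = refl
size-linear e ((a , b) ∷ c) = trans (cong (a * e + b +_) (size-linear e c)) (lemma a b (weight c) (offset c) e)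
  where
  lemma : ∀ a b w o e → a * e + b + (w * e + o) ≡ (a + w) * e + (b + o)
  lemma = solve-∀

part-bounds : All (λ p → 1 ≤ proj₁ p × 21 * proj₁ p ≤ 2 * proj₂ p × proj₂ p ≤ 56) bigParts
part-bounds =
  from-yes (all? (λ p → 1 ≤? proj₁ p ×-dec 21 * proj₁ p ≤? 2 * proj₂ p ×-dec proj₂ p ≤? 56) bigParts)

constant-≤ : ∀ e {p q} → p ∈ bigParts → q ∈ bigParts → value e q ≤ value e p → proj₂ q ≤ proj₂ p
constant-≤ e {a , b} {a′ , b′} p∈ q∈ q≤p with b′ ≤? b
... | yes b′≤b = b′≤b
... | no  b′≰b = contradiction q≤p (<⇒≱ (+-mono-≤-< (*-monoˡ-≤ e (a≤a′ (≰⇒> b′≰b))) (≰⇒> b′≰b)))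
  where
  monotone : All (λ p → All (λ q → proj₂ p < proj₂ q → proj₁ p ≤ proj₁ q) bigParts) bigParts
  monotone =
    from-yes (all? (λ p → all? (λ q → proj₂ p <? proj₂ q →-dec proj₁ p ≤? proj₁ q) bigParts) bigParts)
  a≤a′ : b < b′ → a ≤ a′
  a≤a′ = All.lookup (All.lookup monotone p∈) q∈

length≤weight : ∀ {c} → All (_∈ bigParts) c → length c ≤ weight c
length≤weight []         = z≤n
length≤weight (p∈ ∷ c∈) = +-mono-≤ (proj₁ (All.lookup part-bounds p∈)) (length≤weight c∈)

weight-vs-offset : ∀ {c} → All (_∈ bigParts) c → 21 * weight c ≤ 2 * offset c
weight-vs-offset {[]}          []         = z≤n
weight-vs-offset {(a , b) ∷ c} (p∈ ∷ c∈) = begin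
  21 * (a + weight c)    ≡⟨ *-distribˡ-+ 21 a (weight c) ⟩
  21 * a + 21 * weight c ≤⟨ +-mono-≤ (proj₁ (proj₂ (All.lookup part-bounds p∈))) (weight-vs-offset c∈) ⟩
  2 * b + 2 * offset c   ≡⟨ *-distribˡ-+ 2 b (offset c) ⟨
  2 * (b + offset c)     ∎
  where open ≤-Reasoning

-- Every big part a * e + b has 2 b ≥ 21 a, so a total weight of 6 or more makes the size exceed 5d.
weight≤5 : ∀ e {c} → All (_∈ bigParts) c → size e c ≤ 5 * e + 60 → weight c ≤ 5
weight≤5 e {c} c∈ size≤ with weight c ≤? 5
... | yes w≤5 = w≤5
... | no  w≰5 = contradiction (subst (_≤ 5 * e + 60) (size-linear e c) size≤) (<⇒≱ (begin-strict
    5 * e + 60              <⟨ lemma e ⟩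
    6 * e + 63              ≤⟨ +-mono-≤ (*-monoˡ-≤ e (≰⇒> w≰5)) 63≤o ⟩
    weight c * e + offset c ∎))
  where
  open ≤-Reasoning
  lemma : ∀ e → 5 * e + 60 < 6 * e + 63
  lemma e = subst (5 * e + 60 <_) (eq e) (s≤s (m≤m+n (5 * e + 60) (e + 2)))
    where
    eq : ∀ e → suc (5 * e + 60 + (e + 2)) ≡ 6 * e + 63
    eq = solve-∀
  63≤o : 63 ≤ offset c
  63≤o = *-cancelˡ-≤ 2 (≤-trans (*-monoʳ-≤ 21 (≰⇒> w≰5)) (weight-vs-offset c∈))

Chain : ℕ → List Part → Set
Chain m []      = ⊤
Chain m (p ∷ c) = p ∈ bigParts × proj₂ p ≤ m × Chain (proj₂ p) c

Chain⇒All : ∀ {m} c → Chain m c → All (_∈ bigParts) c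
Chain⇒All []      _               = []
Chain⇒All (p ∷ c) (p∈ , _ , chain) = p∈ ∷ Chain⇒All c chain

fits : ℕ → ℕ → Part → Bool
fits w m p = (proj₁ p ≤ᵇ w) ∧ (proj₂ p ≤ᵇ m)

chains : (f w m : ℕ) → List (List Part)
chains zero    w m = [ [] ]
chains (suc f) w m =
  [] ∷ concatMap (λ p → map (p ∷_) (chains f (w ∸ proj₁ p) (proj₂ p))) (filterᵇ (fits w m) bigParts)

∈-chains⁺ : ∀ f w m {c} → Chain m c → length c ≤ f → weight c ≤ w → c ∈ chains f w m
∈-chains⁺ zero    w m {[]} _ _ _ = here refl
∈-chains⁺ (suc f) w m {[]} _ _ _ = here refl
∈-chains⁺ (suc f) w m {(a , b) ∷ c} (p∈ , b≤m , chain) (s≤s len≤) a+w≤ =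
  there (∈-concat⁺′ (∈-map⁺ ((a , b) ∷_) c∈)
                    (∈-map⁺ (λ p → map (p ∷_) (chains f (w ∸ proj₁ p) (proj₂ p))) p∈′))
  where
  c∈ : c ∈ chains f (w ∸ a) b
  c∈ = ∈-chains⁺ f (w ∸ a) b chain len≤
         (m+n≤o⇒m≤o∸n (weight c) (subst (_≤ w) (+-comm a (weight c)) a+w≤))
  p∈′ : (a , b) ∈ filterᵇ (fits w m) bigParts
  p∈′ = ∈-filter⁺ (T? ∘ fits w m) p∈ (Equivalence.from T-∧ (≤⇒≤ᵇ (m+n≤o⇒m≤o a a+w≤) , ≤⇒≤ᵇ b≤m))
∈-chains⁺ zero    w m {_ ∷ _} _ () _

descending-ones : ∀ {xs} → Descending 1 xs → xs ≡ replicate (length xs) 1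
descending-ones {[]}          _                 = refl
descending-ones {suc zero ∷ xs} (_ , _ , xs↓) = cong (1 ∷_) (descending-ones xs↓)
descending-ones {suc (suc _) ∷ _} (_ , s≤s () , _)

split-ones : ∀ e {m β} xs → Descending m xs → All (Allowed e) xs →
  (∀ {q} → q ∈ bigParts → value e q ≤ m → proj₂ q ≤ β) →
  ∃₂ λ c k → Chain β c × xs ≡ map (value e) c ++ replicate k 1
split-ones e [] _ _ _ = [] , 0 , tt , refl
split-ones e (x ∷ xs) (_ , _ , xs↓) (inj₁ refl ∷ _) _ =
  [] , suc (length xs) , tt , cong (1 ∷_) (descending-ones xs↓)
split-ones e (x ∷ xs) (_ , x≤m , xs↓) (inj₂ x∈ ∷ xs-allowed) bounded
  with p , p∈ , refl ← ∈-map⁻ (value e) {xs = bigParts} x∈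
  with c , k , chain , refl ← split-ones e xs xs↓ xs-allowed (constant-≤ e p∈)
  = p ∷ c , k , (p∈ , bounded p∈ x≤m , chain) , refl

data Target : Set where
  single : Target
  pair   : ℕ → Target
  triple : ℕ → ℕ → Target

_≟ₜ_ : (s t : Target) → Dec (s ≡ t)
single     ≟ₜ single       = yes refl
pair b     ≟ₜ pair b′      with b ≟ b′
... | yes refl = yes refl
... | no  b≢b′ = no λ { refl → b≢b′ refl }
triple c g ≟ₜ triple c′ g′ with c ≟ c′ | g ≟ g′
... | yes refl | yes refl = yes refl
... | no  c≢c′ | _        = no λ { refl → c≢c′ refl }
... | _        | no  g≢g′ = no λ { refl → g≢g′ refl }
single     ≟ₜ pair _       = no λ ()
single     ≟ₜ triple _ _   = no λ ()
pair _     ≟ₜ single       = no λ ()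
pair _     ≟ₜ triple _ _   = no λ ()
triple _ _ ≟ₜ single       = no λ ()
triple _ _ ≟ₜ pair _       = no λ ()

render : ℕ → ℕ → Target → List ℕ
render d n single       = n ∷ []
render d n (pair b)     = n ∸ b ∷ b ∷ []
render d n (triple c g) = n ∸ (c + (c + d + g)) ∷ c + d + g ∷ c ∷ []

Proper : Target → Set
Proper single       = ⊤
Proper (pair b)     = 1 ≤ b
Proper (triple c g) = 1 ≤ c

proper? : ∀ t → Dec (Proper t)
proper? single       = yes tt
proper? (pair b)     = 1 ≤? b
proper? (triple c g) = 1 ≤? c

threshold : ℕ → Target → ℕ
threshold d single       = 1
threshold d (pair b)     = b + d + b
threshold d (triple c g) = c + d + g + d + (c + (c + d + g))

render-injective : ∀ d n {s t} → render d n s ≡ render d n t → s ≡ t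
render-injective d n {single}     {single}       _  = refl
render-injective d n {pair b}     {pair b′}      eq = cong pair (∷-injectiveˡ (∷-injectiveʳ eq))
render-injective d n {triple c g} {triple c′ g′} eq
  with refl ← ∷-injectiveˡ (∷-injectiveʳ (∷-injectiveʳ eq))
  = cong (triple c) (+-cancelˡ-≡ (c + d) g g′ (∷-injectiveˡ (∷-injectiveʳ eq)))
render-injective d n {single}     {pair _}     ()
render-injective d n {single}     {triple _ _} ()
render-injective d n {pair _}     {single}     ()
render-injective d n {pair _}     {triple _ _} ()
render-injective d n {triple _ _} {single}     ()
render-injective d n {triple _ _} {pair _}     ()

gapPartitions : ℕ → ℕ → List (List ℕ)
gapPartitions d n = filterᵇ (gapᵇ d) (partitions n)

∈-gapPartitions⁺ : ∀ d n {xs} → Descending n xs → sum xs ≡ n → T (gapᵇ d xs) → xs ∈ gapPartitions d n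
∈-gapPartitions⁺ d n xs↓ ∑≡ gaps = ∈-filter⁺ (T? ∘ gapᵇ d) (∈-pb⁺ n n n xs↓ ∑≡ ≤-refl) gaps

render-gap : ∀ d n t → Proper t → threshold d t ≤ n → render d n t ∈ gapPartitions d n
render-gap d n single _ 1≤n = ∈-gapPartitions⁺ d n (1≤n , ≤-refl , tt) (+-identityʳ n) tt
render-gap d n (pair b) 1≤b b+d+b≤n =
  ∈-gapPartitions⁺ d n (≤-trans 1≤b b≤n∸b , m∸n≤m n b , 1≤b , b≤n∸b , tt) ∑≡
    (Equivalence.from T-∧ (≤⇒≤ᵇ b+d≤n∸b , tt))
  where
  b+d≤n∸b : b + d ≤ n ∸ b
  b+d≤n∸b = m+n≤o⇒m≤o∸n (b + d) b+d+b≤n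
  b≤n∸b : b ≤ n ∸ b
  b≤n∸b = ≤-trans (m≤m+n b d) b+d≤n∸b
  ∑≡ : n ∸ b + (b + 0) ≡ n
  ∑≡ = trans (cong (n ∸ b +_) (+-identityʳ b)) (m∸n+n≡m (m+n≤o⇒n≤o (b + d) b+d+b≤n))
render-gap d n (triple c g) 1≤c m+d+s≤n =
  ∈-gapPartitions⁺ d n
    (≤-trans 1≤c (≤-trans c≤m m≤n∸s) , m∸n≤m n s , ≤-trans 1≤c c≤m , m≤n∸s , 1≤c , c≤m , tt) ∑≡
    (Equivalence.from T-∧ (≤⇒≤ᵇ m+d≤n∸s , Equivalence.from T-∧ (≤⇒≤ᵇ (m≤m+n (c + d) g) , tt)))
  where
  m = c + d + g
  s = c + m
  m+d≤n∸s : m + d ≤ n ∸ s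
  m+d≤n∸s = m+n≤o⇒m≤o∸n (m + d) m+d+s≤n
  m≤n∸s : m ≤ n ∸ s
  m≤n∸s = ≤-trans (m≤m+n m d) m+d≤n∸s
  c≤m : c ≤ m
  c≤m = ≤-trans (m≤m+n c d) (m≤m+n (c + d) g)
  ∑≡ : n ∸ s + (m + (c + 0)) ≡ n
  ∑≡ = trans (cong (λ k → n ∸ s + (m + k)) (+-identityʳ c))
         (trans (cong (n ∸ s +_) (+-comm m c)) (m∸n+n≡m (m+n≤o⇒n≤o (m + d) m+d+s≤n)))

need : Target → Part
need single       = 0 , 1
need (pair b)     = 1 , 12 + 2 * b
need (triple c g) = 3 , 36 + 3 * c + 2 * g

value-need : ∀ e t → value e (need t) ≡ threshold (12 + e) t
value-need e single       = refl
value-need e (pair b)     = lemma e b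
  where
  lemma : ∀ e b → 1 * e + (12 + 2 * b) ≡ b + (12 + e) + b
  lemma = solve-∀
value-need e (triple c g) = lemma e c g
  where
  lemma : ∀ e c g → 3 * e + (36 + 3 * c + 2 * g) ≡ c + (12 + e) + g + (12 + e) + (c + (c + (12 + e) + g))
  lemma = solve-∀

_≼_ : Part → Part → Set
p ≼ q = proj₁ p ≤ proj₁ q × proj₂ p ≤ proj₂ q

value-mono : ∀ e {p q} → p ≼ q → value e p ≤ value e q
value-mono e (a≤a′ , b≤b′) = +-mono-≤ (*-monoˡ-≤ e a≤a′) b≤b′

-- The injection: each possible list of big parts of a partition counted by Q1m d n, with the
-- gap-d partition of n it is sent to.
table : List (List Part × Target)
table =
  ([] , single) ∷
  (above 5 ∷ [] , triple 2 3) ∷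
  (below 5 ∷ [] , triple 2 1) ∷
  (above 4 ∷ [] , pair 15) ∷
  (above 4 ∷ above 1 ∷ [] , triple 3 2) ∷
  (below 4 ∷ [] , pair 11) ∷
  (below 4 ∷ above 1 ∷ [] , triple 2 2) ∷
  (above 3 ∷ [] , pair 7) ∷
  (above 3 ∷ above 2 ∷ [] , triple 1 5) ∷
  (above 3 ∷ below 2 ∷ [] , triple 3 0) ∷
  (above 3 ∷ above 1 ∷ [] , pair 17) ∷
  (above 3 ∷ above 1 ∷ above 1 ∷ [] , triple 4 1) ∷
  (below 3 ∷ [] , pair 5) ∷
  (below 3 ∷ above 2 ∷ [] , triple 1 3) ∷
  (below 3 ∷ below 2 ∷ [] , triple 2 0) ∷
  (below 3 ∷ above 1 ∷ [] , pair 13) ∷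
  (below 3 ∷ above 1 ∷ above 1 ∷ [] , triple 3 1) ∷
  (above 2 ∷ [] , pair 3) ∷
  (above 2 ∷ above 2 ∷ [] , pair 16) ∷
  (above 2 ∷ above 2 ∷ above 1 ∷ [] , triple 2 4) ∷
  (above 2 ∷ below 2 ∷ [] , pair 12) ∷
  (above 2 ∷ below 2 ∷ above 1 ∷ [] , triple 1 4) ∷
  (above 2 ∷ above 1 ∷ [] , pair 8) ∷
  (above 2 ∷ above 1 ∷ above 1 ∷ [] , triple 1 0) ∷
  (above 2 ∷ above 1 ∷ above 1 ∷ above 1 ∷ [] , triple 1 6) ∷
  (below 2 ∷ [] , pair 2) ∷
  (below 2 ∷ below 2 ∷ [] , pair 10) ∷
  (below 2 ∷ below 2 ∷ above 1 ∷ [] , triple 1 2) ∷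
  (below 2 ∷ above 1 ∷ [] , pair 6) ∷
  (below 2 ∷ above 1 ∷ above 1 ∷ [] , pair 14) ∷
  (below 2 ∷ above 1 ∷ above 1 ∷ above 1 ∷ [] , triple 4 0) ∷
  (above 1 ∷ [] , pair 1) ∷
  (above 1 ∷ above 1 ∷ [] , pair 4) ∷
  (above 1 ∷ above 1 ∷ above 1 ∷ [] , pair 9) ∷
  (above 1 ∷ above 1 ∷ above 1 ∷ above 1 ∷ [] , triple 1 1) ∷
  (above 1 ∷ above 1 ∷ above 1 ∷ above 1 ∷ above 1 ∷ [] , triple 3 3) ∷
  []

table-keys : map proj₁ table ≡ chains 5 5 56
table-keys = refl

-- An entry is usable as soon as its big parts fit into n, given n ≥ d + 2 = value e (1 , 14).
EntryOK : List Part × Target → Set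
EntryOK (c , t) = Proper t × (need t ≼ (weight c , offset c) ⊎ need t ≼ (1 , 14))

table-ok : All EntryOK table
table-ok = from-yes (all? (λ (c , t) → proper? t ×-dec (≼? (need t) (weight c , offset c)
                                                     ⊎-dec ≼? (need t) (1 , 14))) table)
  where
  ≼? : ∀ p q → Dec (p ≼ q)
  ≼? p q = proj₁ p ≤? proj₁ q ×-dec proj₂ p ≤? proj₂ q

table-targets-unique : Unique (map proj₂ table)
table-targets-unique = from-yes (unique? (map proj₂ table))
  where open import Data.List.Relation.Unary.Unique.DecPropositional _≟ₜ_ using (unique?)

fitsIn? : ∀ e n (entry : List Part × Target) → Dec (size e (proj₁ entry) ≤ n)
fitsIn? e n entry = size e (proj₁ entry) ≤? n

active : ℕ → ℕ → List (List Part × Target)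
active e n = filter (fitsIn? e n) table

fill : ℕ → ℕ → List Part → List ℕ
fill e n c = map (value e) c ++ replicate (n ∸ size e c) 1

sum-ones : ∀ k → sum (replicate k 1) ≡ k
sum-ones zero    = refl
sum-ones (suc k) = cong suc (sum-ones k)

okParts⇒Allowed : ∀ e {m} xs → Descending m xs → sum xs ≤ 5 * e + 60 →
  T (allᵇ (okPartᵇ (12 + e)) xs) → All (Allowed e) xs
okParts⇒Allowed e []       _                ∑≤ _  = []
okParts⇒Allowed e (x ∷ xs) (1≤x , _ , xs↓) ∑≤ ok with Equivalence.to T-∧ ok
... | x-ok , xs-ok = okPart⇒Allowed e x x-ok 1≤x (m+n≤o⇒m≤o x ∑≤)
                   ∷ okParts⇒Allowed e xs xs↓ (m+n≤o⇒n≤o x ∑≤) xs-ok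

∈-filter-partitions⁻ : ∀ {p n xs} → xs ∈ filterᵇ p (partitions n) → Descending n xs × sum xs ≡ n × T (p xs)
∈-filter-partitions⁻ {p} {n} xs∈ with xs∈partitions , pxs ← ∈-filter⁻ (T? ∘ p) {xs = partitions n} xs∈ =
  let xs↓ , ∑xs = ∈-pb⁻ n n n xs∈partitions in xs↓ , ∑xs , pxs

sum-padded : ∀ e c k → sum (map (value e) c ++ replicate k 1) ≡ size e c + k
sum-padded e c k = trans (sum-++ (map (value e) c) (replicate k 1)) (cong (size e c +_) (sum-ones k))

table-complete : ∀ e {c} → Chain 56 c → size e c ≤ 5 * e + 60 → Σ Target λ t → (c , t) ∈ table
table-complete e {c} chain size≤ =
  let (_ , t) , entry∈ , c≡ =
        ∈-map⁻ proj₁ (subst (c ∈_) (sym table-keys) (∈-chains⁺ 5 5 56 chain len≤5 w≤5))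
  in t , subst (λ c → (c , t) ∈ table) (sym c≡) entry∈
  where
  c∈ : All (_∈ bigParts) c
  c∈ = Chain⇒All c chain
  w≤5 : weight c ≤ 5
  w≤5 = weight≤5 e c∈ size≤
  len≤5 : length c ≤ 5
  len≤5 = ≤-trans (length≤weight c∈) w≤5

padded-chain-∈ : ∀ e n {c k} → Chain 56 c → size e c + k ≡ n → n ≤ 5 * e + 60 →
  map (value e) c ++ replicate k 1 ∈ map (fill e n ∘ proj₁) (active e n)
padded-chain-∈ e n {c} {k} chain size+k≡n n≤ =
  subst (_∈ map (fill e n ∘ proj₁) (active e n)) (cong (λ k → map (value e) c ++ replicate k 1) k≡)
    (∈-map⁺ (fill e n ∘ proj₁) (∈-filter⁺ (fitsIn? e n) entry∈ size≤n))
  where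
  size≤n : size e c ≤ n
  size≤n = subst (size e c ≤_) size+k≡n (m≤m+n (size e c) k)
  k≡ : n ∸ size e c ≡ k
  k≡ = trans (cong (_∸ size e c) (sym size+k≡n)) (m+n∸m≡n (size e c) k)
  entry∈ : (c , proj₁ (table-complete e chain (≤-trans size≤n n≤))) ∈ table
  entry∈ = proj₂ (table-complete e chain (≤-trans size≤n n≤))

Q-cover : ∀ e n → n ≤ 5 * e + 60 →
  filterᵇ (allᵇ (okPartᵇ (12 + e))) (partitions n) ⊆ map (fill e n ∘ proj₁) (active e n)
Q-cover e n n≤ {xs} xs∈
  with xs↓ , ∑xs , ok ← ∈-filter-partitions⁻ {allᵇ (okPartᵇ (12 + e))} xs∈
  with c , k , chain , refl
         ← split-ones e xs xs↓ (okParts⇒Allowed e xs xs↓ (≤-trans (≤-reflexive ∑xs) n≤) ok)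
                      (λ q∈ _ → proj₂ (proj₂ (All.lookup part-bounds q∈)))
  = padded-chain-∈ e n chain (trans (sym (sum-padded e c k)) ∑xs) n≤

active-fits : ∀ e n {c t} → 12 + e + 2 ≤ n → (c , t) ∈ active e n → Proper t × threshold (12 + e) t ≤ n
active-fits e n {c} {t} d+2≤n entry∈ =
  let entry∈table , size≤n = ∈-filter⁻ (fitsIn? e n) {xs = table} entry∈
      proper , needed      = All.lookup table-ok entry∈table
  in proper , subst (_≤ n) (value-need e t) (need≤n size≤n needed)
  where
  need≤n : size e c ≤ n → need t ≼ (weight c , offset c) ⊎ need t ≼ (1 , 14) → value e (need t) ≤ n
  need≤n size≤n (inj₁ ≼size) = ≤-trans (value-mono e ≼size) (subst (_≤ n) (size-linear e c) size≤n)
  need≤n _      (inj₂ ≼d+2)  = ≤-trans (value-mono e ≼d+2) (subst (_≤ n) (lemma e) d+2≤n)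
    where
    lemma : ∀ e → 12 + e + 2 ≡ 1 * e + 14
    lemma = solve-∀

gap-image : ∀ e n → 12 + e + 2 ≤ n → map (render (12 + e) n ∘ proj₂) (active e n) ⊆ gapPartitions (12 + e) n
gap-image e n d+2≤n ys∈ with (c , t) , entry∈ , refl ← ∈-map⁻ (render (12 + e) n ∘ proj₂) ys∈ =
  let proper , threshold≤n = active-fits e n d+2≤n entry∈ in render-gap (12 + e) n t proper threshold≤n

gap-image-unique : ∀ e n → Unique (map (render (12 + e) n ∘ proj₂) (active e n))
gap-image-unique e n =
  AllPairs.map⁺ {f = render (12 + e) n ∘ proj₂}
    (AllPairs.map (λ t≢t′ eq → t≢t′ (render-injective (12 + e) n eq))
      (AllPairs.filter⁺ (fitsIn? e n) (AllPairs.map⁻ {f = proj₂} {xs = table} table-targets-unique)))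

Q1m≤q1 : ∀ e n → 12 + e + 2 ≤ n → n ≤ 5 * e + 60 → Q1m (12 + e) n ≤ q1 (12 + e) n
Q1m≤q1 e n d+2≤n n≤5d = begin
  Q1m (12 + e) n
    ≤⟨ unique-⊆-length≤ (Unique.filter⁺ (T? ∘ allᵇ (okPartᵇ (12 + e))) (pb-unique n n n))
                         (Q-cover e n n≤5d) ⟩
  length (map (fill e n ∘ proj₁) (active e n))
    ≡⟨ length-map (fill e n ∘ proj₁) (active e n) ⟩
  length (active e n)
    ≡⟨ length-map (render (12 + e) n ∘ proj₂) (active e n) ⟨
  length (map (render (12 + e) n ∘ proj₂) (active e n))
    ≤⟨ unique-⊆-length≤ (gap-image-unique e n) (gap-image e n d+2≤n) ⟩
  q1 (12 + e) n ∎
  where open ≤-Reasoning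

lemma6p2 : (d : ℕ) → 12 ≤ d → (n : ℕ) → d + 2 ≤ n → n ≤ 5 * d →
    q1 d n ≥ Q1m d n
lemma6p2 d 12≤d n d+2≤n n≤5d with e , refl ← m≤n⇒∃[o]m+o≡n 12≤d =
  Q1m≤q1 e n d+2≤n (subst (n ≤_) (lemma e) n≤5d)
  where
  lemma : ∀ e → 5 * (12 + e) ≡ 5 * e + 60
  lemma = solve-∀
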